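{- Let $\Gamma$ be a fan-crossing free drawing of the complete bipartite graph $K_{3,5}$. Then there is a subgraph of $K_{3,5}$ isomorphic to $K_{2,2}$ (i.e., induced by two vertices of one part and two vertices of the other part) no two of whose edges cross each other in $\Gamma$.
   Context: All drawings are simple: vertices are distinct points of the plane, each edge is a Jordan arc between its endpoints not passing through other vertices, no edge crosses itself, any two edges share at most one point (a common endpoint or a proper crossing), and adjacent edges do not cross. A simple drawing is fan-crossing free if no edge is crossed by two edges that share a common endpoint. -}

module Defs where

open import Data.Nat using (ℕ)
open import Data.Fin using (Fin)
open import Data.Bool using (Bool; true; false)
open import Data.Product using (_×_; _,_; proj₁; proj₂; ∃; ∃-syntax)
open import Data.Sum using (_⊎_)
open import Relation.Binary.PropositionalEquality using (_≡_; _≢_)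

-- Complete bipartite graph K_{m,n}: parts Fin m and Fin n, every pair is an edge.
Edge : ℕ → ℕ → Set
Edge m n = Fin m × Fin n

ShareEnd : ∀ {m n} → Edge m n → Edge m n → Set
ShareEnd e f = (proj₁ e ≡ proj₁ f) ⊎ (proj₂ e ≡ proj₂ f)

-- Combinatorial abstraction of a simple drawing of K_{m,n}: the crossing
-- relation between edges (in a simple drawing two edges cross at most once,
-- so "e and f cross" is a yes/no fact).  The properties imposed are the ones
-- every simple drawing satisfies: crossing is symmetric and adjacent edges
-- (in particular an edge with itself) never cross.
record SimpleDrawing (m n : ℕ) : Set where
  field
    cross     : Edge m n → Edge m n → Bool
    cross-sym : ∀ e f → cross e f ≡ cross f e
    adj-nocross : ∀ e f → ShareEnd e f → cross e f ≡ false
open SimpleDrawing public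

FanCrossingFree : ∀ {m n} → SimpleDrawing m n → Set
FanCrossingFree {m} {n} Γ =
  ∀ (e f g : Edge m n) → f ≢ g → ShareEnd f g →
    cross Γ e f ≡ true → cross Γ e g ≡ true → Data.Empty.⊥
  where import Data.Empty

PlanarK22 : ∀ {m n} → SimpleDrawing m n → Fin m → Fin m → Fin n → Fin n → Set
PlanarK22 Γ a1 a2 b1 b2 =
  ∀ (e f : Edge _ _) →
    (proj₁ e ≡ a1 ⊎ proj₁ e ≡ a2) → (proj₂ e ≡ b1 ⊎ proj₂ e ≡ b2) →
    (proj₁ f ≡ a1 ⊎ proj₁ f ≡ a2) → (proj₂ f ≡ b1 ⊎ proj₂ f ≡ b2) →
    cross Γ e f ≡ false

{-# OPTIONS --safe #-}
module Submission where

-- Fix a₁, a₂ and b₀. In the K_{2,2} on {a₁, a₂} × {b₀, b} the only non-adjacent pairs of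
-- edges are a₁b₀, a₂b and a₂b₀, a₁b. Fan-crossing freeness lets a₁b₀ be crossed by at
-- most one edge at a₂, and a₂b₀ by at most one edge at a₁, so at most two choices of b
-- make this K_{2,2} crossed; trying three of them therefore suffices.

open import Defs
open import Data.Nat using (ℕ)
open import Data.Fin using (Fin; zero; suc; _≟_)
open import Data.Product using (Σ; _×_; _,_)
open import Data.Sum using (_⊎_; inj₁; inj₂)
open import Data.Bool using (true; false)
open import Data.Empty using (⊥-elim)
open import Relation.Nullary using (yes; no)
open import Relation.Binary.PropositionalEquality using (_≡_; _≢_; refl; trans)

private
  variable
    m n : ℕ

planarK22-if-opposite-uncrossed : ∀ (Γ : SimpleDrawing m n) a₁ a₂ b₁ b₂ →
  cross Γ (a₁ , b₁) (a₂ , b₂) ≡ false → cross Γ (a₂ , b₁) (a₁ , b₂) ≡ false →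
  PlanarK22 Γ a₁ a₂ b₁ b₂
planarK22-if-opposite-uncrossed Γ a₁ a₂ b₁ b₂ x y = go
  where
  go : PlanarK22 Γ a₁ a₂ b₁ b₂
  go (_ , _) (_ , _) (inj₁ refl) _ (inj₁ refl) _ = adj-nocross Γ _ _ (inj₁ refl)
  go (_ , _) (_ , _) (inj₂ refl) _ (inj₂ refl) _ = adj-nocross Γ _ _ (inj₁ refl)
  go (_ , _) (_ , _) _ (inj₁ refl) _ (inj₁ refl) = adj-nocross Γ _ _ (inj₂ refl)
  go (_ , _) (_ , _) _ (inj₂ refl) _ (inj₂ refl) = adj-nocross Γ _ _ (inj₂ refl)
  go (_ , _) (_ , _) (inj₁ refl) (inj₁ refl) (inj₂ refl) (inj₂ refl) = x
  go (_ , _) (_ , _) (inj₂ refl) (inj₂ refl) (inj₁ refl) (inj₁ refl) = trans (cross-sym Γ _ _) x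
  go (_ , _) (_ , _) (inj₂ refl) (inj₁ refl) (inj₁ refl) (inj₂ refl) = y
  go (_ , _) (_ , _) (inj₁ refl) (inj₂ refl) (inj₂ refl) (inj₁ refl) = trans (cross-sym Γ _ _) y

Blocked : SimpleDrawing m n → Fin m → Fin m → Fin n → Fin n → Set
Blocked Γ a₁ a₂ b₀ b = cross Γ (a₁ , b₀) (a₂ , b) ≡ true ⊎ cross Γ (a₂ , b₀) (a₁ , b) ≡ true

planarK22-or-blocked : ∀ (Γ : SimpleDrawing m n) a₁ a₂ b₀ b →
  PlanarK22 Γ a₁ a₂ b₀ b ⊎ Blocked Γ a₁ a₂ b₀ b
planarK22-or-blocked Γ a₁ a₂ b₀ b
  with cross Γ (a₁ , b₀) (a₂ , b) in x | cross Γ (a₂ , b₀) (a₁ , b) in y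
... | true  | _     = inj₂ (inj₁ refl)
... | false | true  = inj₂ (inj₂ refl)
... | false | false = inj₁ (planarK22-if-opposite-uncrossed Γ a₁ a₂ b₀ b x y)

module _ (Γ : SimpleDrawing m n) (fcf : FanCrossingFree Γ) where

  crossed-by-fan-once : ∀ {e a b c} →
    cross Γ e (a , b) ≡ true → cross Γ e (a , c) ≡ true → b ≡ c
  crossed-by-fan-once {e} {a} {b} {c} eb ec with b ≟ c
  ... | yes b≡c = b≡c
  ... | no b≢c = ⊥-elim (fcf e (a , b) (a , c) (λ { refl → b≢c refl }) (inj₁ refl) eb ec)

  blocked-at-most-twice : ∀ {a₁ a₂ b₀ b₁ b₂ b₃} →
    Blocked Γ a₁ a₂ b₀ b₁ → Blocked Γ a₁ a₂ b₀ b₂ → Blocked Γ a₁ a₂ b₀ b₃ →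
    b₁ ≡ b₂ ⊎ b₁ ≡ b₃ ⊎ b₂ ≡ b₃
  blocked-at-most-twice (inj₁ p) (inj₁ q) _ = inj₁ (crossed-by-fan-once p q)
  blocked-at-most-twice (inj₂ p) (inj₂ q) _ = inj₁ (crossed-by-fan-once p q)
  blocked-at-most-twice (inj₁ p) _ (inj₁ q) = inj₂ (inj₁ (crossed-by-fan-once p q))
  blocked-at-most-twice (inj₂ p) _ (inj₂ q) = inj₂ (inj₁ (crossed-by-fan-once p q))
  blocked-at-most-twice _ (inj₁ p) (inj₁ q) = inj₂ (inj₂ (crossed-by-fan-once p q))
  blocked-at-most-twice _ (inj₂ p) (inj₂ q) = inj₂ (inj₂ (crossed-by-fan-once p q))

lemma1 : (Γ : SimpleDrawing 3 5) → FanCrossingFree Γ →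
    Σ (Fin 3) λ a1 → Σ (Fin 3) λ a2 → Σ (Fin 5) λ b1 → Σ (Fin 5) λ b2 →
    (a1 ≢ a2) × (b1 ≢ b2) × PlanarK22 Γ a1 a2 b1 b2
lemma1 Γ fcf with try (suc zero) | try (suc (suc zero)) | try (suc (suc (suc zero)))
  where
  try : ∀ b → PlanarK22 Γ zero (suc zero) zero b ⊎ Blocked Γ zero (suc zero) zero b
  try = planarK22-or-blocked Γ zero (suc zero) zero
... | inj₁ planar | _           | _           = zero , suc zero , zero , _ , (λ ()) , (λ ()) , planar
... | _           | inj₁ planar | _           = zero , suc zero , zero , _ , (λ ()) , (λ ()) , planar
... | _           | _           | inj₁ planar = zero , suc zero , zero , _ , (λ ()) , (λ ()) , planar
... | inj₂ x      | inj₂ y      | inj₂ z      with blocked-at-most-twice Γ fcf x y z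
...   | inj₁ ()
...   | inj₂ (inj₁ ())
...   | inj₂ (inj₂ ())
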